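{- Let $A,B\in\mathbb{Z}$ with $AB\neq0$ and $k\in\{1,2\}$. Let $f(x)=x^6+Ax^{2k}+B$, $g(x)=x^3+Ax^k+B$ and $h(x)=x^6+(-1)^kAB^{k-1}x^{6-2k}-B^2$. Suppose $f(x)$ is irreducible over $\mathbb{Q}$. If $h(x)$ is reducible over $\mathbb{Q}$, then $\Delta(g)<0$.
   Context: $\Delta(g)$ denotes the discriminant of $g$. -}

module Defs where

open import Data.Nat using (ℕ; zero; suc; _≤_)
open import Data.Integer as ℤ using (ℤ; +_; -[1+_])
open import Data.Rational as ℚ using (ℚ; 0ℚ; _/_)
open import Data.List using (List; []; _∷_; map; replicate; _++_)
open import Data.Product using (Σ; ∃; _×_; _,_)
open import Data.Sum using (_⊎_)
open import Relation.Binary.PropositionalEquality using (_≡_; _≢_)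

-- Polynomials over a ring as coefficient lists, lowest degree first.
-- Polynomials over ℚ
Polyℚ : Set
Polyℚ = List ℚ

coeff : Polyℚ → ℕ → ℚ
coeff []       _       = 0ℚ
coeff (a ∷ p)  zero    = a
coeff (a ∷ p)  (suc n) = coeff p n

addP : Polyℚ → Polyℚ → Polyℚ
addP []      q       = q
addP p       []      = p
addP (a ∷ p) (b ∷ q) = (a ℚ.+ b) ∷ addP p q

mulP : Polyℚ → Polyℚ → Polyℚ
mulP []      q = []
mulP (a ∷ p) q = addP (map (a ℚ.*_) q) (0ℚ ∷ mulP p q)

_≈P_ : Polyℚ → Polyℚ → Set
p ≈P q = ∀ n → coeff p n ≡ coeff q n

IsConstant : Polyℚ → Set
IsConstant p = ∀ n → 1 ≤ n → coeff p n ≡ 0ℚ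

NonConstant : Polyℚ → Set
NonConstant p = Σ ℕ λ n → 1 ≤ n × coeff p n ≢ 0ℚ

-- irreducible over ℚ: not zero/unit (nonconstant), and every factorization
-- has a unit (i.e. constant, necessarily nonzero) factor
Irreducible : Polyℚ → Set
Irreducible p = NonConstant p ×
  (∀ u v → p ≈P mulP u v → IsConstant u ⊎ IsConstant v)

Reducible : Polyℚ → Set
Reducible p = Σ Polyℚ λ u → Σ Polyℚ λ v →
  NonConstant u × NonConstant v × p ≈P mulP u v

Polyℤ : Set
Polyℤ = List ℤ

toℚ : Polyℤ → Polyℚ
toℚ = map (λ z → z / 1)

monoℤ : ℤ → ℕ → Polyℤ
monoℤ c d = replicate d (+ 0) ++ (c ∷ [])

addℤ : Polyℤ → Polyℤ → Polyℤ
addℤ []      q       = q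
addℤ p       []      = p
addℤ (a ∷ p) (b ∷ q) = (a ℤ.+ b) ∷ addℤ p q

coeffℤ : Polyℤ → ℕ → ℤ
coeffℤ []      _       = + 0
coeffℤ (a ∷ p) zero    = a
coeffℤ (a ∷ p) (suc n) = coeffℤ p n

discCubic : Polyℤ → ℤ
discCubic p =
  let d = coeffℤ p 0 ; c = coeffℤ p 1 ; b = coeffℤ p 2 ; a = coeffℤ p 3 in
  (b ℤ.* b ℤ.* c ℤ.* c) ℤ.- (+ 4 ℤ.* a ℤ.* c ℤ.* c ℤ.* c)
    ℤ.- (+ 4 ℤ.* b ℤ.* b ℤ.* b ℤ.* d) ℤ.- (+ 27 ℤ.* a ℤ.* a ℤ.* d ℤ.* d)
    ℤ.+ (+ 18 ℤ.* a ℤ.* b ℤ.* c ℤ.* d)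

fPoly : ℤ → ℤ → ℕ → Polyℤ
fPoly A B k = addℤ (monoℤ (+ 1) 6) (addℤ (monoℤ A (2 Data.Nat.* k)) (monoℤ B 0))

gPoly : ℤ → ℤ → ℕ → Polyℤ
gPoly A B k = addℤ (monoℤ (+ 1) 3) (addℤ (monoℤ A k) (monoℤ B 0))

hPoly : ℤ → ℤ → ℕ → Polyℤ
hPoly A B k = addℤ (monoℤ (+ 1) 6)
  (addℤ (monoℤ ((ℤ.- (+ 1)) ℤ.^ k ℤ.* A ℤ.* B ℤ.^ (k Data.Nat.∸ 1))
                (6 Data.Nat.∸ 2 Data.Nat.* k))
        (monoℤ (ℤ.- (B ℤ.* B)) 0))

module Submission where

open import Defs

-- Write g = x³ + a₂x² + a₁x + a₀, so that f(x) = g(x²) and h(x) = H(x²) for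
-- H(y) = y³ − a₁y² + a₂a₀y − a₀², the cubic with y³·g(−a₀/y) = a₀·H(y).
-- If f is irreducible, g has no rational root, hence neither has H. Comparing
-- coefficients in a factorisation of h into monic factors then leaves only
-- h(x) = −P(x)·P(−x) for a monic cubic P = x³ + ax² + bx + c. For k = 1, 2 the
-- resulting relations between a, b, c and A, B make a positive multiple of Δ(g)
-- equal to minus a sum of squares, so Δ(g) ≤ 0; and Δ(g) = 0 is impossible, since
-- g would then have a rational double root.

module Rational where
  open import Agda.Builtin.FromNat using (Number; fromNat)
  open import Data.Unit using (tt)
  open import Data.Nat as ℕ using (ℕ; zero; suc; z≤n; s≤s)
  import Data.Nat.Literals as ℕ
  import Data.Nat.Properties as ℕ
  open import Data.Rational as ℚ using (ℚ; 0ℚ; 1ℚ; _+_; _*_; -_; _-_; 1/_; _≤_; _<_)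
  import Data.Rational.Literals as ℚ
  open import Data.Rational.Properties
  open import Data.List using ([]; _∷_; map)
  open import Data.Product using (Σ; ∃-syntax; _×_; _,_)
  open import Data.Sum using (_⊎_; inj₁; inj₂; [_,_]′)
  open import Function using (_∘_; id)
  open import Level using (0ℓ)
  open import Relation.Nullary.Decidable using (yes; no; dec⇒maybe)
  open import Relation.Nullary.Negation using (¬_; contradiction)
  open import Relation.Binary.PropositionalEquality
  open import Relation.Binary.Definitions using (tri<; tri≈; tri>)
  open import Tactic.RingSolver using (solve; solve-∀)
  open import Tactic.RingSolver.Core.AlmostCommutativeRing
    using (AlmostCommutativeRing; fromCommutativeRing)

  instance
    ℕ-number : Number ℕ
    ℕ-number = ℕ.number
    ℚ-number : Number ℚ
    ℚ-number = ℚ.number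

  ℚ-ring : AlmostCommutativeRing 0ℓ 0ℓ
  ℚ-ring = fromCommutativeRing +-*-commutativeRing (λ x → dec⇒maybe (0ℚ ≟ x))

  p*q≡0⇒p≡0 : ∀ p q → p * q ≡ 0ℚ → q ≢ 0ℚ → p ≡ 0ℚ
  p*q≡0⇒p≡0 p q pq≡0 q≢0 = begin
    p              ≡⟨ sym (*-identityʳ p) ⟩
    p * 1ℚ         ≡⟨ cong (p *_) (sym (*-inverseʳ q)) ⟩
    p * (q * 1/ q) ≡⟨ sym (*-assoc p q (1/ q)) ⟩
    p * q * 1/ q   ≡⟨ cong (_* 1/ q) pq≡0 ⟩
    0ℚ * 1/ q      ≡⟨ *-zeroˡ (1/ q) ⟩
    0ℚ             ∎
    where
    open ≡-Reasoning
    instance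
      q-nonZero : ℚ.NonZero q
      q-nonZero = ℚ.≢-nonZero q≢0

  p*1/q*q≡p : ∀ p q → .{{_ : ℚ.NonZero q}} → p * 1/ q * q ≡ p
  p*1/q*q≡p p q = trans (*-assoc p (1/ q) q) (trans (cong (p *_) (*-inverseˡ q)) (*-identityʳ p))

  *-nonzero : ∀ {p q} → p ≢ 0ℚ → q ≢ 0ℚ → p * q ≢ 0ℚ
  *-nonzero p≢0 q≢0 pq≡0 = p≢0 (p*q≡0⇒p≡0 _ _ pq≡0 q≢0)

  p*p≡0⇒p≡0 : ∀ p → p * p ≡ 0ℚ → p ≡ 0ℚ
  p*p≡0⇒p≡0 p pp≡0 with p ≟ 0ℚ
  ... | yes p≡0 = p≡0
  ... | no  p≢0 = p*q≡0⇒p≡0 p p pp≡0 p≢0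

  p≡q⇒p-q≡0 : ∀ {p q} → p ≡ q → p - q ≡ 0ℚ
  p≡q⇒p-q≡0 {p} refl = +-inverseʳ p

  *-nonneg : ∀ {p q} → 0ℚ ≤ p → 0ℚ ≤ q → 0ℚ ≤ p * q
  *-nonneg {p} {q} 0≤p 0≤q = subst (_≤ p * q) (*-zeroʳ p) (*-monoˡ-≤-nonNeg p {{ℚ.nonNegative 0≤p}} 0≤q)

  *-pos : ∀ {p q} → 0ℚ < p → 0ℚ < q → 0ℚ < p * q
  *-pos {p} {q} 0<p 0<q = subst (_< p * q) (*-zeroˡ q) (*-monoˡ-<-pos q {{ℚ.positive 0<q}} 0<p)

  neg-square : ∀ p → - p * - p ≡ p * p
  neg-square = solve-∀ ℚ-ring

  square-nonneg : ∀ p → 0ℚ ≤ p * p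
  square-nonneg p with ≤-total 0ℚ p
  ... | inj₁ 0≤p = *-nonneg 0≤p 0≤p
  ... | inj₂ p≤0 = subst (0ℚ ≤_) (neg-square p) (*-nonneg (neg-antimono-≤ p≤0) (neg-antimono-≤ p≤0))

  square-pos : ∀ {p} → p ≢ 0ℚ → 0ℚ < p * p
  square-pos {p} p≢0 with <-cmp 0ℚ p
  ... | tri< 0<p _ _ = *-pos 0<p 0<p
  ... | tri≈ _ 0≡p _ = contradiction (sym 0≡p) p≢0
  ... | tri> _ _ p<0 = subst (0ℚ <_) (neg-square p) (*-pos (neg-antimono-< p<0) (neg-antimono-< p<0))

  square-times-positive-definite : ∀ u v w → 0ℚ ≤ u * u * (v * v + 8 * (w * w))
  square-times-positive-definite u v w =
    *-nonneg (square-nonneg u) (+-mono-≤ (square-nonneg v) (*-nonneg (nonNegative⁻¹ 8) (square-nonneg w)))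

  scaled-nonpositive : ∀ {k D S} → 0ℚ < k → k * D ≡ - S → 0ℚ ≤ S → D ≤ 0ℚ
  scaled-nonpositive {k} {D} {S} 0<k kD≡-S 0≤S = *-cancelˡ-≤-pos k {{ℚ.positive 0<k}} (begin
    k * D    ≡⟨ kD≡-S ⟩
    - S      ≤⟨ neg-antimono-≤ 0≤S ⟩
    0ℚ       ≡⟨ sym (*-zeroʳ k) ⟩
    k * 0ℚ   ∎)
    where open ≤-Reasoning

  ≤∧≢⇒< : ∀ {p q} → p ≤ q → p ≢ q → p < q
  ≤∧≢⇒< {p} {q} p≤q p≢q with <-cmp p q
  ... | tri< p<q _ _ = p<q
  ... | tri≈ _ p≡q _ = contradiction p≡q p≢q
  ... | tri> _ _ q<p = contradiction (≤-<-trans p≤q q<p) (<-irrefl refl)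

  -- Certificates that x − y lies in the ideal generated by the aᵢ, with explicit multipliers lᵢ.
  record Combination₂ (x y l₁ a₁ l₂ a₂ : ℚ) : Set where
    constructor combination
    field identity : x ≡ y + (l₁ * a₁ + l₂ * a₂)

  record Combination₃ (x y l₁ a₁ l₂ a₂ l₃ a₃ : ℚ) : Set where
    constructor combination
    field identity : x ≡ y + (l₁ * a₁ + l₂ * a₂ + l₃ * a₃)

  record Combination₄ (x y l₁ a₁ l₂ a₂ l₃ a₃ l₄ a₄ : ℚ) : Set where
    constructor combination
    field identity : x ≡ y + (l₁ * a₁ + l₂ * a₂ + l₃ * a₃ + l₄ * a₄)

  vanish₂ : ∀ {x y l₁ a₁ l₂ a₂} → Combination₂ x y l₁ a₁ l₂ a₂ → a₁ ≡ 0ℚ → a₂ ≡ 0ℚ → x ≡ y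
  vanish₂ {y = y} {l₁} {l₂ = l₂} (combination x≡) refl refl = trans x≡ (solve (y ∷ l₁ ∷ l₂ ∷ []) ℚ-ring)

  vanish₃ : ∀ {x y l₁ a₁ l₂ a₂ l₃ a₃} → Combination₃ x y l₁ a₁ l₂ a₂ l₃ a₃ →
    a₁ ≡ 0ℚ → a₂ ≡ 0ℚ → a₃ ≡ 0ℚ → x ≡ y
  vanish₃ {y = y} {l₁} {l₂ = l₂} {l₃ = l₃} (combination x≡) refl refl refl =
    trans x≡ (solve (y ∷ l₁ ∷ l₂ ∷ l₃ ∷ []) ℚ-ring)

  vanish₄ : ∀ {x y l₁ a₁ l₂ a₂ l₃ a₃ l₄ a₄} → Combination₄ x y l₁ a₁ l₂ a₂ l₃ a₃ l₄ a₄ →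
    a₁ ≡ 0ℚ → a₂ ≡ 0ℚ → a₃ ≡ 0ℚ → a₄ ≡ 0ℚ → x ≡ y
  vanish₄ {y = y} {l₁} {l₂ = l₂} {l₃ = l₃} {l₄ = l₄} (combination x≡) refl refl refl refl =
    trans x≡ (solve (y ∷ l₁ ∷ l₂ ∷ l₃ ∷ l₄ ∷ []) ℚ-ring)

  -- Coefficients of products

  conv : (ℕ → ℚ) → (ℕ → ℚ) → ℕ → ℚ
  conv f g zero    = f 0 * g 0
  conv f g (suc n) = f 0 * g (suc n) + conv (f ∘ suc) g n

  DegreeAtMost : ℕ → (ℕ → ℚ) → Set
  DegreeAtMost d f = ∀ i → d ℕ.< i → f i ≡ 0ℚ

  coeff-addP : ∀ p q n → coeff (addP p q) n ≡ coeff p n + coeff q n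
  coeff-addP []      q       n       = sym (+-identityˡ _)
  coeff-addP (a ∷ p) []      n       = sym (+-identityʳ _)
  coeff-addP (a ∷ p) (b ∷ q) zero    = refl
  coeff-addP (a ∷ p) (b ∷ q) (suc n) = coeff-addP p q n

  coeff-map-* : ∀ a q n → coeff (map (a *_) q) n ≡ a * coeff q n
  coeff-map-* a []      n       = sym (*-zeroʳ a)
  coeff-map-* a (b ∷ q) zero    = refl
  coeff-map-* a (b ∷ q) (suc n) = coeff-map-* a q n

  conv-zeroˡ : ∀ {f} g → (∀ i → f i ≡ 0ℚ) → ∀ n → conv f g n ≡ 0ℚ
  conv-zeroˡ g f≡0 zero    = trans (cong (_* g 0) (f≡0 0)) (*-zeroˡ (g 0))
  conv-zeroˡ {f} g f≡0 (suc n) = begin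
    f 0 * g (suc n) + conv (f ∘ suc) g n ≡⟨ cong₂ _+_ (cong (_* g (suc n)) (f≡0 0)) (conv-zeroˡ g (f≡0 ∘ suc) n) ⟩
    0ℚ * g (suc n) + 0ℚ                  ≡⟨ cong (_+ 0ℚ) (*-zeroˡ (g (suc n))) ⟩
    0ℚ                                   ∎
    where open ≡-Reasoning

  coeff-mulP : ∀ p q n → coeff (mulP p q) n ≡ conv (coeff p) (coeff q) n
  coeff-mulP []      q n = sym (conv-zeroˡ (coeff q) (λ _ → refl) n)
  coeff-mulP (a ∷ p) q zero = begin
    coeff (addP (map (a *_) q) (0ℚ ∷ mulP p q)) 0 ≡⟨ coeff-addP (map (a *_) q) _ 0 ⟩
    coeff (map (a *_) q) 0 + 0ℚ                   ≡⟨ +-identityʳ (coeff (map (a *_) q) 0) ⟩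
    coeff (map (a *_) q) 0                        ≡⟨ coeff-map-* a q 0 ⟩
    a * coeff q 0                                 ∎
    where open ≡-Reasoning
  coeff-mulP (a ∷ p) q (suc n) = begin
    coeff (addP (map (a *_) q) (0ℚ ∷ mulP p q)) (suc n)   ≡⟨ coeff-addP (map (a *_) q) _ (suc n) ⟩
    coeff (map (a *_) q) (suc n) + coeff (mulP p q) n     ≡⟨ cong₂ _+_ (coeff-map-* a q (suc n)) (coeff-mulP p q n) ⟩
    a * coeff q (suc n) + conv (coeff p) (coeff q) n      ∎
    where open ≡-Reasoning

  conv-scale : ∀ f g a b n → conv (λ i → f i * a) (λ j → g j * b) n ≡ conv f g n * (a * b)
  conv-scale f g a b zero    = interchange (f 0) a (g 0) b
    where interchange : ∀ x a y b → x * a * (y * b) ≡ x * y * (a * b)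
          interchange = solve-∀ ℚ-ring
  conv-scale f g a b (suc n) = begin
    f 0 * a * (g (suc n) * b) + conv (λ i → f (suc i) * a) (λ j → g j * b) n
      ≡⟨ cong (f 0 * a * (g (suc n) * b) +_) (conv-scale (f ∘ suc) g a b n) ⟩
    f 0 * a * (g (suc n) * b) + conv (f ∘ suc) g n * (a * b)
      ≡⟨ distribute (f 0) (g (suc n)) (conv (f ∘ suc) g n) a b ⟩
    (f 0 * g (suc n) + conv (f ∘ suc) g n) * (a * b) ∎
    where
    open ≡-Reasoning
    distribute : ∀ x y z a b → x * a * (y * b) + z * (a * b) ≡ (x * y + z) * (a * b)
    distribute = solve-∀ ℚ-ring

  conv-sucʳ : ∀ f g n → conv f g (suc n) ≡ conv f (g ∘ suc) n + f (suc n) * g 0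
  conv-sucʳ f g zero    = refl
  conv-sucʳ f g (suc n) = begin
    f 0 * g (suc (suc n)) + conv (f ∘ suc) g (suc n)
      ≡⟨ cong (f 0 * g (suc (suc n)) +_) (conv-sucʳ (f ∘ suc) g n) ⟩
    f 0 * g (suc (suc n)) + (conv (f ∘ suc) (g ∘ suc) n + f (suc (suc n)) * g 0)
      ≡⟨ sym (+-assoc (f 0 * g (suc (suc n))) _ _) ⟩
    f 0 * g (suc (suc n)) + conv (f ∘ suc) (g ∘ suc) n + f (suc (suc n)) * g 0 ∎
    where open ≡-Reasoning

  conv-comm : ∀ f g → conv f g ≗ conv g f
  conv-comm f g zero    = *-comm (f 0) (g 0)
  conv-comm f g (suc n) = begin
    f 0 * g (suc n) + conv (f ∘ suc) g n ≡⟨ cong₂ _+_ (*-comm (f 0) _) (conv-comm (f ∘ suc) g n) ⟩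
    g (suc n) * f 0 + conv g (f ∘ suc) n ≡⟨ +-comm (g (suc n) * f 0) _ ⟩
    conv g (f ∘ suc) n + g (suc n) * f 0 ≡⟨ sym (conv-sucʳ g f n) ⟩
    conv g f (suc n)                     ∎
    where open ≡-Reasoning

  conv-degree : ∀ {f g} m n → DegreeAtMost m f → DegreeAtMost n g → DegreeAtMost (m ℕ.+ n) (conv f g)
  conv-degree {f} {g} zero    n f≤0 g≤n (suc i) (s≤s n≤i) = begin
    f 0 * g (suc i) + conv (f ∘ suc) g i ≡⟨ cong₂ _+_ (cong (f 0 *_) (g≤n (suc i) (s≤s n≤i)))
                                                   (conv-zeroˡ g (λ j → f≤0 (suc j) (s≤s z≤n)) i) ⟩
    f 0 * 0ℚ + 0ℚ                        ≡⟨ cong (_+ 0ℚ) (*-zeroʳ (f 0)) ⟩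
    0ℚ                                   ∎
    where open ≡-Reasoning
  conv-degree {f} {g} (suc m) n f≤m g≤n (suc i) (s≤s m+n<i) = begin
    f 0 * g (suc i) + conv (f ∘ suc) g i ≡⟨ cong₂ _+_ (cong (f 0 *_) (g≤n (suc i) (s≤s (ℕ.≤-trans (ℕ.m≤n+m n m) (ℕ.<⇒≤ m+n<i)))))
                                                   (conv-degree m n (λ j m<j → f≤m (suc j) (s≤s m<j)) g≤n i m+n<i) ⟩
    f 0 * 0ℚ + 0ℚ                        ≡⟨ cong (_+ 0ℚ) (*-zeroʳ (f 0)) ⟩
    0ℚ                                   ∎
    where open ≡-Reasoning

  conv-top : ∀ {f g} m n → DegreeAtMost m f → DegreeAtMost n g → conv f g (m ℕ.+ n) ≡ f m * g n
  conv-top         zero    zero    f≤0 g≤0 = refl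
  conv-top {f} {g} zero    (suc n) f≤0 g≤n = begin
    f 0 * g (suc n) + conv (f ∘ suc) g n ≡⟨ cong (f 0 * g (suc n) +_) (conv-zeroˡ g (λ j → f≤0 (suc j) (s≤s z≤n)) n) ⟩
    f 0 * g (suc n) + 0ℚ                 ≡⟨ +-identityʳ (f 0 * g (suc n)) ⟩
    f 0 * g (suc n)                      ∎
    where open ≡-Reasoning
  conv-top {f} {g} (suc m) n f≤m g≤n = begin
    f 0 * g (suc (m ℕ.+ n)) + conv (f ∘ suc) g (m ℕ.+ n)
      ≡⟨ cong₂ _+_ (cong (f 0 *_) (g≤n (suc (m ℕ.+ n)) (s≤s (ℕ.m≤n+m n m))))
                   (conv-top m n (λ j m<j → f≤m (suc j) (s≤s m<j)) g≤n) ⟩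
    f 0 * 0ℚ + f (suc m) * g n
      ≡⟨ cong (_+ f (suc m) * g n) (*-zeroʳ (f 0)) ⟩
    0ℚ + f (suc m) * g n
      ≡⟨ +-identityˡ (f (suc m) * g n) ⟩
    f (suc m) * g n ∎
    where open ≡-Reasoning

  -- For literal d and n this unfolds to Σ_{i ≤ min d n} f i * g (n − i) with no zero terms,
  -- the form in which the coefficient comparisons below are stated.
  conv≤ : ℕ → (ℕ → ℚ) → (ℕ → ℚ) → ℕ → ℚ
  conv≤ d       f g zero    = f 0 * g 0
  conv≤ zero    f g (suc n) = f 0 * g (suc n)
  conv≤ (suc d) f g (suc n) = f 0 * g (suc n) + conv≤ d (f ∘ suc) g n

  conv≡conv≤ : ∀ {f} d g → DegreeAtMost d f → conv f g ≗ conv≤ d f g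
  conv≡conv≤             d       g f≤d zero    = refl
  conv≡conv≤ {f} zero    g f≤0 (suc n) = begin
    f 0 * g (suc n) + conv (f ∘ suc) g n ≡⟨ cong (f 0 * g (suc n) +_) (conv-zeroˡ g (λ j → f≤0 (suc j) (s≤s z≤n)) n) ⟩
    f 0 * g (suc n) + 0ℚ                 ≡⟨ +-identityʳ (f 0 * g (suc n)) ⟩
    f 0 * g (suc n)                      ∎
    where open ≡-Reasoning
  conv≡conv≤ {f} (suc d) g f≤d (suc n) =
    cong (f 0 * g (suc n) +_) (conv≡conv≤ d g (λ j d<j → f≤d (suc j) (s≤s d<j)) n)

  conv-oneˡ : ∀ g → conv (coeff (1ℚ ∷ [])) g ≗ g
  conv-oneˡ g zero    = *-identityˡ (g 0)
  conv-oneˡ g (suc n) = begin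
    1ℚ * g (suc n) + conv (coeff []) g n ≡⟨ cong (1ℚ * g (suc n) +_) (conv-zeroˡ g (λ _ → refl) n) ⟩
    1ℚ * g (suc n) + 0ℚ                  ≡⟨ +-identityʳ (1ℚ * g (suc n)) ⟩
    1ℚ * g (suc n)                       ≡⟨ *-identityˡ (g (suc n)) ⟩
    g (suc n)                            ∎
    where open ≡-Reasoning

  conv-x²-minus : ∀ r g n → conv (coeff (- r ∷ 0ℚ ∷ 1ℚ ∷ [])) g (suc (suc n)) ≡ g n - r * g (suc (suc n))
  conv-x²-minus r g n =
    trans (cong (λ t → - r * g (suc (suc n)) + (0ℚ * g (suc n) + t)) (conv-oneˡ g n))
          (shape r (g (suc (suc n))) (g (suc n)) (g n))
    where
    shape : ∀ r a b c → - r * a + (0ℚ * b + c) ≡ c - r * a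
    shape = solve-∀ ℚ-ring

  irreducible-resp : ∀ {p q} → p ≈P q → Irreducible p → Irreducible q
  irreducible-resp p≈q ((i , 1≤i , p[i]≢0) , irr) =
    (i , 1≤i , λ q[i]≡0 → p[i]≢0 (trans (p≈q i) q[i]≡0)) , λ u v q≈uv → irr u v (λ n → trans (p≈q n) (q≈uv n))

  reducible-resp : ∀ {p q} → p ≈P q → Reducible p → Reducible q
  reducible-resp p≈q (u , v , u-nc , v-nc , p≈uv) = u , v , u-nc , v-nc , λ n → trans (sym (p≈q n)) (p≈uv n)

  -- Monic factorisations

  last-nonzero : ∀ p → (∀ i → coeff p i ≡ 0ℚ) ⊎ Σ ℕ λ d → coeff p d ≢ 0ℚ × DegreeAtMost d (coeff p)
  last-nonzero []      = inj₁ (λ _ → refl)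
  last-nonzero (a ∷ p) with last-nonzero p
  ... | inj₂ (d , p[d]≢0 , p≤d) = inj₂ (suc d , p[d]≢0 , λ where (suc i) (s≤s d<i) → p≤d i d<i)
  ... | inj₁ p≡0 with a ≟ 0ℚ
  ...   | yes a≡0 = inj₁ λ where zero → a≡0 ; (suc i) → p≡0 i
  ...   | no  a≢0 = inj₂ (0 , a≢0 , λ where (suc i) _ → p≡0 i)

  leading-coefficient : ∀ u → NonConstant u →
    Σ ℕ λ d → coeff u (suc d) ≢ 0ℚ × DegreeAtMost (suc d) (coeff u)
  leading-coefficient u (i , 1≤i , u[i]≢0) with last-nonzero u
  ... | inj₁ u≡0                  = contradiction (u≡0 i) u[i]≢0
  ... | inj₂ (zero  , _ , u≤0)    = contradiction (u≤0 i 1≤i) u[i]≢0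
  ... | inj₂ (suc d , u[d]≢0 , u≤d) = d , u[d]≢0 , u≤d

  record MonicFactorisation (n : ℕ) (c : ℕ → ℚ) : Set where
    constructor factors
    field
      d e      : ℕ
      P Q      : ℕ → ℚ
      1≤d      : 1 ℕ.≤ d
      1≤e      : 1 ℕ.≤ e
      d+e≡n    : d ℕ.+ e ≡ n
      P-monic  : P d ≡ 1ℚ
      Q-monic  : Q e ≡ 1ℚ
      P-degree : DegreeAtMost d P
      Q-degree : DegreeAtMost e Q
      c≗PQ     : c ≗ conv≤ d P Q

  monic-factorisation : ∀ {n c} u v → NonConstant u → NonConstant v →
    c n ≡ 1ℚ → DegreeAtMost n c → (∀ i → c i ≡ coeff (mulP u v) i) → MonicFactorisation n c
  monic-factorisation {n} {c} u v u-nc v-nc c[n]≡1 c≤n c≗uv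
    with leading-coefficient u u-nc | leading-coefficient v v-nc
  ... | m , w≢0 , u≤m | k , v[k]≢0 , v≤k = factors (suc m) (suc k) P Q (s≤s z≤n) (s≤s z≤n) degrees-add-up
    (*-inverseʳ w) Q-monic P-degree Q-degree (λ i → trans (c≗PQ i) (conv≡conv≤ (suc m) Q P-degree i))
    where
    w : ℚ
    w = coeff u (suc m)
    instance
      w-nonZero : ℚ.NonZero w
      w-nonZero = ℚ.≢-nonZero w≢0
    P Q : ℕ → ℚ
    P i = coeff u i * 1/ w
    Q j = coeff v j * w
    P-degree : DegreeAtMost (suc m) P
    P-degree i m<i = trans (cong (_* 1/ w) (u≤m i m<i)) (*-zeroˡ (1/ w))
    Q-degree : DegreeAtMost (suc k) Q
    Q-degree j k<j = trans (cong (_* w) (v≤k j k<j)) (*-zeroˡ w)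
    c≗PQ : c ≗ conv P Q
    c≗PQ i = begin
      c i                                          ≡⟨ c≗uv i ⟩
      coeff (mulP u v) i                           ≡⟨ coeff-mulP u v i ⟩
      conv (coeff u) (coeff v) i                   ≡⟨ sym (*-identityʳ _) ⟩
      conv (coeff u) (coeff v) i * 1ℚ              ≡⟨ cong (conv (coeff u) (coeff v) i *_) (sym (*-inverseˡ w)) ⟩
      conv (coeff u) (coeff v) i * (1/ w * w)      ≡⟨ sym (conv-scale (coeff u) (coeff v) (1/ w) w i) ⟩
      conv P Q i                                   ∎
      where open ≡-Reasoning
    top : conv P Q (suc m ℕ.+ suc k) ≡ Q (suc k)
    top = trans (conv-top (suc m) (suc k) P-degree Q-degree)
                (trans (cong (_* Q (suc k)) (*-inverseʳ w)) (*-identityˡ (Q (suc k))))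
    degrees-add-up : suc m ℕ.+ suc k ≡ n
    degrees-add-up with ℕ.<-cmp (suc m ℕ.+ suc k) n
    ... | tri< m+k<n _ _ = contradiction (trans (sym c[n]≡1) (trans (c≗PQ n)
                             (conv-degree (suc m) (suc k) P-degree Q-degree n m+k<n))) 1≢0
    ... | tri≈ _ m+k≡n _ = m+k≡n
    ... | tri> _ _ n<m+k = contradiction (trans (sym top) (trans (sym (c≗PQ _)) (c≤n _ n<m+k)))
                             (λ Q≡0 → v[k]≢0 (p*q≡0⇒p≡0 _ w Q≡0 w≢0))
    Q-monic : Q (suc k) ≡ 1ℚ
    Q-monic = trans (sym top) (trans (sym (c≗PQ _)) (trans (cong c degrees-add-up) c[n]≡1))

  swap : ∀ {n c} → MonicFactorisation n c → MonicFactorisation n c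
  swap (factors d e P Q 1≤d 1≤e d+e≡n P-monic Q-monic P-degree Q-degree c≗PQ) =
    factors e d Q P 1≤e 1≤d (trans (ℕ.+-comm e d) d+e≡n) Q-monic P-monic Q-degree P-degree
      (λ i → trans (c≗PQ i) (trans (sym (conv≡conv≤ d Q P-degree i))
                           (trans (conv-comm P Q i) (conv≡conv≤ e P Q-degree i))))

  sorted : ∀ {n c} → MonicFactorisation n c →
    Σ (MonicFactorisation n c) λ F → MonicFactorisation.d F ℕ.≤ MonicFactorisation.e F
  sorted F with ℕ.≤-total (MonicFactorisation.d F) (MonicFactorisation.e F)
  ... | inj₁ d≤e = F , d≤e
  ... | inj₂ e≤d = swap F , e≤d

  -- Factorisations of even sextics

  -- INLINE lets the ring solver see through cubic (likewise disc₁, disc₂ and discriminant).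
  cubic : ℚ → ℚ → ℚ → ℚ → ℚ
  cubic c₀ c₁ c₂ x = x * x * x + c₂ * (x * x) + c₁ * x + c₀
  {-# INLINE cubic #-}

  -- x⁶ + c₄x⁴ + c₂x² + c₀, the composite of cubic c₀ c₂ c₄ with x²
  evenSextic : ℚ → ℚ → ℚ → Polyℚ
  evenSextic c₀ c₂ c₄ = c₀ ∷ 0ℚ ∷ c₂ ∷ 0ℚ ∷ c₄ ∷ 0ℚ ∷ 1ℚ ∷ []

  evenSextic-degree : ∀ {c₀ c₂ c₄} → DegreeAtMost 6 (coeff (evenSextic c₀ c₂ c₄))
  evenSextic-degree _ (s≤s (s≤s (s≤s (s≤s (s≤s (s≤s (s≤s _))))))) = refl

  evenSextic-cong : ∀ {c₀ c₂ c₄ d₀ d₂ d₄} → c₀ ≡ d₀ → c₂ ≡ d₂ → c₄ ≡ d₄ → evenSextic c₀ c₂ c₄ ≈P evenSextic d₀ d₂ d₄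
  evenSextic-cong refl refl refl _ = refl

  -- x⁶ + c₄x⁴ + c₂x² + c₀ = −P(x)·P(−x) for P = x³ + ax² + bx + c
  Mirrored : ℚ → ℚ → ℚ → Set
  Mirrored c₀ c₂ c₄ = ∃[ a ] ∃[ b ] ∃[ c ]
    c₄ ≡ b + b - a * a × c₂ ≡ b * b - (a * c + a * c) × c₀ ≡ - (c * c)

  Splitting : ℚ → ℚ → ℚ → Set
  Splitting c₀ c₂ c₄ = (∃[ y ] cubic c₀ c₂ c₄ y ≡ 0ℚ) ⊎ Mirrored c₀ c₂ c₄

  splitting-cong : ∀ {c₀ c₂ c₄ d₀ d₂ d₄} → c₀ ≡ d₀ → c₂ ≡ d₂ → c₄ ≡ d₄ → Splitting d₀ d₂ d₄ → Splitting c₀ c₂ c₄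
  splitting-cong refl refl refl s = s

  -- Below, the factors are P = Σ pᵢxⁱ and Q = Σ qⱼxʲ; their leading and vanishing coefficients
  -- are variables pinned by equations, so that the products are literally the unfolded conv≤ sums.
  linear-factor-certificate : ∀ (p₀ p₁ q₀ q₁ q₂ q₃ q₄ q₅ : ℚ) → p₁ ≡ 1ℚ → q₅ ≡ 1ℚ →
    Combination₃ (cubic (p₀ * q₀) (p₀ * q₂ + p₁ * q₁) (p₀ * q₄ + p₁ * q₃) (p₀ * p₀)) 0ℚ
      p₀                        (p₀ * q₁ + p₁ * q₀)
      (p₀ * p₀ * p₀)            (p₀ * q₃ + p₁ * q₂)
      (p₀ * p₀ * p₀ * p₀ * p₀)  (p₀ * q₅ + p₁ * q₄)
  linear-factor-certificate p₀ _ q₀ q₁ q₂ q₃ q₄ _ refl refl =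
    combination (solve (p₀ ∷ q₀ ∷ q₁ ∷ q₂ ∷ q₃ ∷ q₄ ∷ []) ℚ-ring)

  even-quadratic-factor-root : ∀ (p₀ p₁ p₂ q₀ q₁ q₂ q₃ q₄ q₅ : ℚ) → p₁ ≡ 0ℚ → p₂ ≡ 1ℚ → q₄ ≡ 1ℚ → q₅ ≡ 0ℚ →
    cubic (p₀ * q₀) (p₀ * q₂ + (p₁ * q₁ + p₂ * q₀)) (p₀ * q₄ + (p₁ * q₃ + p₂ * q₂)) (- p₀) ≡ 0ℚ
  even-quadratic-factor-root p₀ _ _ q₀ q₁ q₂ q₃ _ _ refl refl refl refl =
    solve (p₀ ∷ q₀ ∷ q₁ ∷ q₂ ∷ q₃ ∷ []) ℚ-ring

  quadratic-factor-certificate : ∀ (p₀ p₁ p₂ q₀ q₁ q₂ q₃ q₄ q₅ : ℚ) → p₂ ≡ 1ℚ → q₄ ≡ 1ℚ → q₅ ≡ 0ℚ →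
    Combination₃
      (cubic (p₀ * q₀) (p₀ * q₂ + (p₁ * q₁ + p₂ * q₀)) (p₀ * q₄ + (p₁ * q₃ + p₂ * q₂)) (p₀ - q₂) * p₁) 0ℚ
      (p₀ + p₀ - q₂)                                                          (p₀ * q₁ + p₁ * q₀)
      (p₀ * p₁ * p₁ + p₀ * q₂ - 2 * (p₀ * p₀) - p₁ * p₁ * q₂)                 (p₀ * q₃ + (p₁ * q₂ + p₂ * q₁))
      (2 * (p₀ * p₀ * p₀) + p₁ * p₁ * q₂ * q₂ - p₀ * p₁ * p₁ * q₂ - p₀ * p₀ * q₂) (p₀ * q₅ + (p₁ * q₄ + p₂ * q₃))
  quadratic-factor-certificate p₀ p₁ _ q₀ q₁ q₂ q₃ _ _ refl refl refl =
    combination (solve (p₀ ∷ p₁ ∷ q₀ ∷ q₁ ∷ q₂ ∷ q₃ ∷ []) ℚ-ring)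

  cubic-factor-certificate : ∀ (p₀ p₁ p₂ p₃ q₀ q₁ q₂ q₃ q₄ q₅ : ℚ) → p₃ ≡ 1ℚ → q₃ ≡ 1ℚ → q₄ ≡ 0ℚ → q₅ ≡ 0ℚ →
    Combination₄
      (cubic (p₀ * q₀) (p₀ * q₂ + (p₁ * q₁ + p₂ * q₀)) (p₀ * q₄ + (p₁ * q₃ + (p₂ * q₂ + p₃ * q₁))) (p₂ * p₂)) 0ℚ
      (2 * (p₂ * q₁) + 2 * (p₂ * p₂ * p₂) + p₀ - p₂ * p₁)   (p₂ * p₁ - p₀)
      p₂                                                  (p₀ * q₁ + p₁ * q₀)
      (p₂ * p₂ * p₂ + p₀ - p₂ * p₁)                         (p₀ * q₃ + (p₁ * q₂ + (p₂ * q₁ + p₃ * q₀)))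
      (p₂ * p₁ * p₁ + p₂ * p₂ * p₀ - p₂ * p₂ * p₂ * p₁ + p₂ * p₂ * p₂ * p₂ * p₂ - p₁ * p₀)
                                                          (p₀ * q₅ + (p₁ * q₄ + (p₂ * q₃ + p₃ * q₂)))
  cubic-factor-certificate p₀ p₁ p₂ _ q₀ q₁ q₂ _ _ _ refl refl refl refl =
    combination (solve (p₀ ∷ p₁ ∷ p₂ ∷ q₀ ∷ q₁ ∷ q₂ ∷ []) ℚ-ring)

  cubic-factor-symmetry-certificate : ∀ (p₀ p₁ p₂ p₃ q₀ q₁ q₂ q₃ q₄ q₅ : ℚ) → p₃ ≡ 1ℚ → q₃ ≡ 1ℚ → q₄ ≡ 0ℚ → q₅ ≡ 0ℚ →
    Combination₃ ((p₁ - q₁) * (p₂ * p₁ - p₀)) 0ℚ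
      1ℚ        (p₀ * q₁ + p₁ * q₀)
      (- p₁)    (p₀ * q₃ + (p₁ * q₂ + (p₂ * q₁ + p₃ * q₀)))
      (p₁ * p₁) (p₀ * q₅ + (p₁ * q₄ + (p₂ * q₃ + p₃ * q₂)))
  cubic-factor-symmetry-certificate p₀ p₁ p₂ _ q₀ q₁ q₂ _ _ _ refl refl refl refl =
    combination (solve (p₀ ∷ p₁ ∷ p₂ ∷ q₀ ∷ q₁ ∷ q₂ ∷ []) ℚ-ring)

  cubic-factor-mirror-certificate₄ : ∀ (p₀ p₁ p₂ p₃ q₀ q₁ q₂ q₃ q₄ q₅ : ℚ) → p₃ ≡ 1ℚ → q₃ ≡ 1ℚ → q₄ ≡ 0ℚ → q₅ ≡ 0ℚ →
    Combination₂ (p₀ * q₄ + (p₁ * q₃ + (p₂ * q₂ + p₃ * q₁))) (p₁ + p₁ - p₂ * p₂)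
      p₂     (p₀ * q₅ + (p₁ * q₄ + (p₂ * q₃ + p₃ * q₂)))
      (- 1ℚ) (p₁ - q₁)
  cubic-factor-mirror-certificate₄ p₀ p₁ p₂ _ q₀ q₁ q₂ _ _ _ refl refl refl refl =
    combination (solve (p₀ ∷ p₁ ∷ p₂ ∷ q₀ ∷ q₁ ∷ q₂ ∷ []) ℚ-ring)

  cubic-factor-mirror-certificate₂ : ∀ (p₀ p₁ p₂ p₃ q₀ q₁ q₂ q₃ q₄ q₅ : ℚ) → p₃ ≡ 1ℚ → q₃ ≡ 1ℚ → q₄ ≡ 0ℚ → q₅ ≡ 0ℚ →
    Combination₃ (p₀ * q₂ + (p₁ * q₁ + p₂ * q₀)) (p₁ * p₁ - (p₂ * p₀ + p₂ * p₀))
      (p₀ - p₂ * p₁)  (p₀ * q₅ + (p₁ * q₄ + (p₂ * q₃ + p₃ * q₂)))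
      p₂              (p₀ * q₃ + (p₁ * q₂ + (p₂ * q₁ + p₃ * q₀)))
      (p₂ * p₂ - p₁)  (p₁ - q₁)
  cubic-factor-mirror-certificate₂ p₀ p₁ p₂ _ q₀ q₁ q₂ _ _ _ refl refl refl refl =
    combination (solve (p₀ ∷ p₁ ∷ p₂ ∷ q₀ ∷ q₁ ∷ q₂ ∷ []) ℚ-ring)

  cubic-factor-mirror-certificate₀ : ∀ (p₀ p₁ p₂ p₃ q₀ q₁ q₂ q₃ q₄ q₅ : ℚ) → p₃ ≡ 1ℚ → q₃ ≡ 1ℚ → q₄ ≡ 0ℚ → q₅ ≡ 0ℚ →
    Combination₃ (p₀ * q₀) (- (p₀ * p₀))
      (- (p₁ * p₀)) (p₀ * q₅ + (p₁ * q₄ + (p₂ * q₃ + p₃ * q₂)))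
      p₀            (p₀ * q₃ + (p₁ * q₂ + (p₂ * q₁ + p₃ * q₀)))
      (p₂ * p₀)     (p₁ - q₁)
  cubic-factor-mirror-certificate₀ p₀ p₁ p₂ _ q₀ q₁ q₂ _ _ _ refl refl refl refl =
    combination (solve (p₀ ∷ p₁ ∷ p₂ ∷ q₀ ∷ q₁ ∷ q₂ ∷ []) ℚ-ring)

  quadratic-factor : ∀ (P Q : ℕ → ℚ) → P 2 ≡ 1ℚ → Q 4 ≡ 1ℚ → Q 5 ≡ 0ℚ →
    conv≤ 2 P Q 1 ≡ 0ℚ → conv≤ 2 P Q 3 ≡ 0ℚ → conv≤ 2 P Q 5 ≡ 0ℚ →
    Splitting (conv≤ 2 P Q 0) (conv≤ 2 P Q 2) (conv≤ 2 P Q 4)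
  quadratic-factor P Q P₂ Q₄ Q₅ m₁ m₃ m₅ with P 1 ≟ 0ℚ
  ... | yes P₁≡0 = inj₁ (- P 0 ,
    even-quadratic-factor-root (P 0) (P 1) (P 2) (Q 0) (Q 1) (Q 2) (Q 3) (Q 4) (Q 5) P₁≡0 P₂ Q₄ Q₅)
  ... | no  P₁≢0 = inj₁ (P 0 - Q 2 , p*q≡0⇒p≡0 _ (P 1)
    (vanish₃ (quadratic-factor-certificate (P 0) (P 1) (P 2) (Q 0) (Q 1) (Q 2) (Q 3) (Q 4) (Q 5) P₂ Q₄ Q₅) m₁ m₃ m₅) P₁≢0)

  cubic-factor : ∀ (P Q : ℕ → ℚ) → P 3 ≡ 1ℚ → Q 3 ≡ 1ℚ → Q 4 ≡ 0ℚ → Q 5 ≡ 0ℚ →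
    conv≤ 3 P Q 1 ≡ 0ℚ → conv≤ 3 P Q 3 ≡ 0ℚ → conv≤ 3 P Q 5 ≡ 0ℚ →
    Splitting (conv≤ 3 P Q 0) (conv≤ 3 P Q 2) (conv≤ 3 P Q 4)
  cubic-factor P Q P₃ Q₃ Q₄ Q₅ m₁ m₃ m₅ with P 2 * P 1 - P 0 ≟ 0ℚ
  ... | yes ab≡c = inj₁ (P 2 * P 2 , vanish₄
    (cubic-factor-certificate (P 0) (P 1) (P 2) (P 3) (Q 0) (Q 1) (Q 2) (Q 3) (Q 4) (Q 5) P₃ Q₃ Q₄ Q₅) ab≡c m₁ m₃ m₅)
  ... | no  ab≢c = inj₂ (P 2 , P 1 , P 0 ,
    vanish₂ (cubic-factor-mirror-certificate₄ (P 0) (P 1) (P 2) (P 3) (Q 0) (Q 1) (Q 2) (Q 3) (Q 4) (Q 5) P₃ Q₃ Q₄ Q₅) m₅ b≡e ,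
    vanish₃ (cubic-factor-mirror-certificate₂ (P 0) (P 1) (P 2) (P 3) (Q 0) (Q 1) (Q 2) (Q 3) (Q 4) (Q 5) P₃ Q₃ Q₄ Q₅) m₅ m₃ b≡e ,
    vanish₃ (cubic-factor-mirror-certificate₀ (P 0) (P 1) (P 2) (P 3) (Q 0) (Q 1) (Q 2) (Q 3) (Q 4) (Q 5) P₃ Q₃ Q₄ Q₅) m₅ m₃ b≡e)
    where
    b≡e : P 1 - Q 1 ≡ 0ℚ
    b≡e = p*q≡0⇒p≡0 (P 1 - Q 1) (P 2 * P 1 - P 0) (vanish₃
      (cubic-factor-symmetry-certificate (P 0) (P 1) (P 2) (P 3) (Q 0) (Q 1) (Q 2) (Q 3) (Q 4) (Q 5) P₃ Q₃ Q₄ Q₅) m₁ m₃ m₅) ab≢c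

  even-sextic-splitting : ∀ {c₀ c₂ c₄} → Reducible (evenSextic c₀ c₂ c₄) → Splitting c₀ c₂ c₄
  even-sextic-splitting (u , v , u-nc , v-nc , h≈uv) =
    split (sorted (monic-factorisation u v u-nc v-nc refl evenSextic-degree h≈uv))
    where
    split : ∀ {c₀ c₂ c₄} → Σ (MonicFactorisation 6 (coeff (evenSextic c₀ c₂ c₄)))
      (λ F → MonicFactorisation.d F ℕ.≤ MonicFactorisation.e F) → Splitting c₀ c₂ c₄
    split (factors 1 _ P Q _ _ refl P₁ Q₅ _ _ c≗PQ , _) = splitting-cong (c≗PQ 0) (c≗PQ 2) (c≗PQ 4) (inj₁ (P 0 * P 0 ,
      vanish₃ (linear-factor-certificate (P 0) (P 1) (Q 0) (Q 1) (Q 2) (Q 3) (Q 4) (Q 5) P₁ Q₅)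
        (sym (c≗PQ 1)) (sym (c≗PQ 3)) (sym (c≗PQ 5))))
    split (factors 2 _ P Q _ _ refl P₂ Q₄ _ Q≤4 c≗PQ , _) = splitting-cong (c≗PQ 0) (c≗PQ 2) (c≗PQ 4)
      (quadratic-factor P Q P₂ Q₄ (Q≤4 5 ℕ.≤-refl) (sym (c≗PQ 1)) (sym (c≗PQ 3)) (sym (c≗PQ 5)))
    split (factors 3 _ P Q _ _ refl P₃ Q₃ _ Q≤3 c≗PQ , _) = splitting-cong (c≗PQ 0) (c≗PQ 2) (c≗PQ 4)
      (cubic-factor P Q P₃ Q₃ (Q≤3 4 ℕ.≤-refl) (Q≤3 5 (ℕ.n≤1+n 4)) (sym (c≗PQ 1)) (sym (c≗PQ 3)) (sym (c≗PQ 5)))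
    split (factors 4 _ _ _ _ _ refl _ _ _ _ _ , s≤s (s≤s ()))
    split (factors 5 _ _ _ _ _ refl _ _ _ _ _ , s≤s ())
    split (factors 6 _ _ _ _ _ refl _ _ _ _ _ , ())

  -- Monic cubics

  x²-minus-times-even-quartic : ∀ r v₀ v₂ →
    evenSextic (- r * v₀) (v₀ - r * v₂) (v₂ - r) ≈P mulP (- r ∷ 0ℚ ∷ 1ℚ ∷ []) (v₀ ∷ 0ℚ ∷ v₂ ∷ 0ℚ ∷ 1ℚ ∷ [])
  x²-minus-times-even-quartic r v₀ v₂ n = trans (coefficient n) (sym (coeff-mulP U V n))
    where
    U V : Polyℚ
    U = - r ∷ 0ℚ ∷ 1ℚ ∷ []
    V = v₀ ∷ 0ℚ ∷ v₂ ∷ 0ℚ ∷ 1ℚ ∷ []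
    coefficient : ∀ n → coeff (evenSextic (- r * v₀) (v₀ - r * v₂) (v₂ - r)) n ≡ conv (coeff U) (coeff V) n
    coefficient 0 = refl
    coefficient 1 = sym (cong₂ _+_ (*-zeroʳ (- r)) (*-zeroˡ v₀))
    coefficient 2 = sym (conv-x²-minus r (coeff V) 0)
    coefficient 3 = sym (trans (conv-x²-minus r (coeff V) 1) (cong (λ t → 0ℚ - t) (*-zeroʳ r)))
    coefficient 4 = sym (trans (conv-x²-minus r (coeff V) 2) (cong (λ t → v₂ - t) (*-identityʳ r)))
    coefficient 5 = sym (trans (conv-x²-minus r (coeff V) 3) (cong (λ t → 0ℚ - t) (*-zeroʳ r)))
    coefficient 6 = sym (trans (conv-x²-minus r (coeff V) 4) (cong (λ t → 1ℚ - t) (*-zeroʳ r)))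
    coefficient n@(suc (suc (suc (suc (suc (suc (suc _))))))) = coeff-mulP U V n

  irreducible⇒no-root : ∀ {a₀ a₁ a₂} → Irreducible (evenSextic a₀ a₁ a₂) → ¬ (∃[ r ] cubic a₀ a₁ a₂ r ≡ 0ℚ)
  irreducible⇒no-root {a₀} {a₁} {a₂} (_ , irr) (r , g[r]≡0) =
    [ (λ U-constant → 1≢0 (U-constant 2 (s≤s z≤n))) , (λ V-constant → 1≢0 (V-constant 4 (s≤s z≤n))) ]′ (irr U V f≈UV)
    where
    U V : Polyℚ
    U = - r ∷ 0ℚ ∷ 1ℚ ∷ []
    V = r * r + a₂ * r + a₁ ∷ 0ℚ ∷ r + a₂ ∷ 0ℚ ∷ 1ℚ ∷ []
    a₀≡ : a₀ ≡ - r * (r * r + a₂ * r + a₁)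
    a₀≡ = trans (split-off r a₀ a₁ a₂) (trans (cong (- r * (r * r + a₂ * r + a₁) +_) g[r]≡0) (+-identityʳ _))
      where
      split-off : ∀ r a₀ a₁ a₂ → a₀ ≡ - r * (r * r + a₂ * r + a₁) + cubic a₀ a₁ a₂ r
      split-off = solve-∀ ℚ-ring
    a₁≡ : ∀ r a₁ a₂ → a₁ ≡ (r * r + a₂ * r + a₁) - r * (r + a₂)
    a₁≡ = solve-∀ ℚ-ring
    a₂≡ : ∀ r a₂ → a₂ ≡ (r + a₂) - r
    a₂≡ = solve-∀ ℚ-ring
    f≈UV : evenSextic a₀ a₁ a₂ ≈P mulP U V
    f≈UV n = trans (evenSextic-cong a₀≡ (a₁≡ r a₁ a₂) (a₂≡ r a₂) n) (x²-minus-times-even-quartic r _ _ n)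

  half-root-certificate : ∀ r y a₀ a₁ a₂ →
    Combination₂ (cubic a₀ a₁ a₂ r * (y * y * y)) 0ℚ
      (r * y * (r * y) - r * y * a₀ + a₀ * a₀ + a₂ * y * (r * y - a₀) + a₁ * (y * y))  (r * y + a₀)
      a₀                                                                        (cubic (- (a₀ * a₀)) (a₂ * a₀) (- a₁) y)
  half-root-certificate r y a₀ a₁ a₂ = combination (solve (r ∷ y ∷ a₀ ∷ a₁ ∷ a₂ ∷ []) ℚ-ring)

  half-root⇒root : ∀ {a₀ a₁ a₂ y} → a₀ ≢ 0ℚ → cubic (- (a₀ * a₀)) (a₂ * a₀) (- a₁) y ≡ 0ℚ →
    ∃[ r ] cubic a₀ a₁ a₂ r ≡ 0ℚ
  half-root⇒root {a₀} {a₁} {a₂} {y} a₀≢0 H[y]≡0 = r ,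
    p*q≡0⇒p≡0 _ (y * y * y) (vanish₂ (half-root-certificate r y a₀ a₁ a₂) ry+a₀≡0 H[y]≡0)
      (*-nonzero (*-nonzero y≢0 y≢0) y≢0)
    where
    at-zero : ∀ c₀ c₁ c₂ → cubic c₀ c₁ c₂ 0ℚ ≡ c₀
    at-zero = solve-∀ ℚ-ring
    y≢0 : y ≢ 0ℚ
    y≢0 refl = *-nonzero a₀≢0 a₀≢0 (neg-injective (trans (sym (at-zero (- (a₀ * a₀)) (a₂ * a₀) (- a₁))) H[y]≡0))
    instance
      y-nonZero : ℚ.NonZero y
      y-nonZero = ℚ.≢-nonZero y≢0
    r : ℚ
    r = - a₀ * 1/ y
    ry+a₀≡0 : r * y + a₀ ≡ 0ℚ
    ry+a₀≡0 = trans (cong (_+ a₀) (p*1/q*q≡p (- a₀) y)) (+-inverseˡ a₀)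

  -- Δ(x³ + αx + β) and Δ(x³ + αx² + β)
  disc₁ disc₂ : ℚ → ℚ → ℚ
  disc₁ α β = - (4 * (α * α * α)) - 27 * (β * β)
  disc₂ α β = - (4 * (α * α * α) * β) - 27 * (β * β)
  {-# INLINE disc₁ #-}
  {-# INLINE disc₂ #-}

  double-root₁-certificate : ∀ r α β →
    Combination₂ (cubic β α 0ℚ r * (2 * α * (2 * α) * (2 * α))) 0ℚ
      (r * (2 * α) * (r * (2 * α)) - 3 * (r * (2 * α) * β) + 9 * (β * β) + 4 * (α * α * α))  (r * (2 * α) + 3 * β)
      β                                                                                (disc₁ α β)
  double-root₁-certificate r α β = combination (solve (r ∷ α ∷ β ∷ []) ℚ-ring)

  double-root₁ : ∀ {α β} → α ≢ 0ℚ → disc₁ α β ≡ 0ℚ → ∃[ r ] cubic β α 0ℚ r ≡ 0ℚ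
  double-root₁ {α} {β} α≢0 Δ≡0 = r ,
    p*q≡0⇒p≡0 _ (s * s * s) (vanish₂ (double-root₁-certificate r α β) rs+3β≡0 Δ≡0)
      (*-nonzero (*-nonzero s≢0 s≢0) s≢0)
    where
    s : ℚ
    s = 2 * α
    s≢0 : s ≢ 0ℚ
    s≢0 = *-nonzero {2} (λ ()) α≢0
    instance
      s-nonZero : ℚ.NonZero s
      s-nonZero = ℚ.≢-nonZero s≢0
    -- the double root when Δ = 0
    r : ℚ
    r = - (3 * β) * 1/ s
    rs+3β≡0 : r * s + 3 * β ≡ 0ℚ
    rs+3β≡0 = trans (cong (_+ 3 * β) (p*1/q*q≡p (- (3 * β)) s)) (+-inverseˡ (3 * β))

  double-root₂-certificate : ∀ r α β →
    Combination₂ (cubic β 0ℚ α r * (27 * β)) 0ℚ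
      (r * 3 * α * β + r * 3 * (r * 3) * β - 2 * (α * α * β))  (r * 3 + 2 * α)
      (- 1ℚ)                                                 (disc₂ α β)
  double-root₂-certificate r α β = combination (solve (r ∷ α ∷ β ∷ []) ℚ-ring)

  double-root₂ : ∀ {α β} → β ≢ 0ℚ → disc₂ α β ≡ 0ℚ → ∃[ r ] cubic β 0ℚ α r ≡ 0ℚ
  double-root₂ {α} {β} β≢0 Δ≡0 = r ,
    p*q≡0⇒p≡0 _ (27 * β) (vanish₂ (double-root₂-certificate r α β) 3r+2α≡0 Δ≡0) (*-nonzero {27} (λ ()) β≢0)
    where
    -- the double root when Δ = 0
    r : ℚ
    r = - (2 * α) * 1/ 3
    3r+2α≡0 : r * 3 + 2 * α ≡ 0ℚ
    3r+2α≡0 = trans (cong (_+ 2 * α) (p*1/q*q≡p (- (2 * α)) 3)) (+-inverseˡ (2 * α))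

  -- Under the mirror relations 108a²·Δ is minus a square times a positive definite form.
  mirrored-disc₁-certificate : ∀ α β a b c →
    Combination₃ (a * a * 108 * disc₁ α β)
      (- ((b - (a * a + a * a)) * (b - (a * a + a * a))
          * ((27 * b - 10 * (a * a)) * (27 * b - 10 * (a * a)) + 8 * (a * a * (a * a)))))
      (1728 * (a * a * b * b) + 432 * (a * a * α * α) + 432 * (a * a * a * a * α) + 432 * (a * a * a * a * a * a)
        - 864 * (a * a * b * α) - 1728 * (a * a * a * a * b))
                                          (- α - (b + b - a * a))
      (- (729 * (b * b + (a * c + a * c)))) (0ℚ * β - (b * b - (a * c + a * c)))
      (2916 * (a * a))                      (- (β * β) - - (c * c))
  mirrored-disc₁-certificate α β a b c = combination (solve (α ∷ β ∷ a ∷ b ∷ c ∷ []) ℚ-ring)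

  mirrored⇒disc₁≤0 : ∀ {α β} → α ≢ 0ℚ → Mirrored (- (β * β)) (0ℚ * β) (- α) → disc₁ α β ≤ 0ℚ
  mirrored⇒disc₁≤0 {α} {β} α≢0 (a , b , c , e₄ , e₂ , e₀) with a ≟ 0ℚ
  ... | no a≢0 = scaled-nonpositive (*-pos (square-pos a≢0) (positive⁻¹ 108))
    (vanish₃ (mirrored-disc₁-certificate α β a b c) (p≡q⇒p-q≡0 e₄) (p≡q⇒p-q≡0 e₂) (p≡q⇒p-q≡0 e₀))
    (square-times-positive-definite (b - (a * a + a * a)) (27 * b - 10 * (a * a)) (a * a))
  ... | yes a≡0 = contradiction (vanish₃ α-certificate (p≡q⇒p-q≡0 e₄) a≡0 b≡0) α≢0
    where
    b-certificate : Combination₂ (b * b) 0ℚ (- 1ℚ) (0ℚ * β - (b * b - (a * c + a * c))) (c + c) a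
    b-certificate = combination (solve (β ∷ a ∷ b ∷ c ∷ []) ℚ-ring)
    b≡0 : b ≡ 0ℚ
    b≡0 = p*p≡0⇒p≡0 b (vanish₂ b-certificate (p≡q⇒p-q≡0 e₂) a≡0)
    α-certificate : Combination₃ α 0ℚ (- 1ℚ) (- α - (b + b - a * a)) a a (- 2) b
    α-certificate = combination (solve (α ∷ a ∷ b ∷ []) ℚ-ring)

  mirrored-disc₂-certificate : ∀ α β a b c →
    Combination₃ (β * β * 1728 * disc₂ α β)
      (- ((c + c - a * a * a) * (c + c - a * a * a)
          * ((108 * c - 10 * (a * a * a)) * (108 * c - 10 * (a * a * a)) + 8 * (a * a * a * (a * a * a)))))
      (3456 * (b * b * b * b * b) + 1728 * (a * a * b * b * b * b) + 864 * (a * a * a * a * b * b * b)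
        + 432 * (a * a * a * a * a * a * b * b) + 216 * (a * a * a * a * a * a * a * a * b)
        + 108 * (a * a * a * a * a * a * a * a * a * a) + 41472 * (a * a * b * c * c) + 20736 * (a * a * a * a * c * c)
        - 20736 * (a * b * b * b * c) - 10368 * (a * a * a * b * b * c) - 5184 * (a * a * a * a * a * b * c)
        - 2592 * (a * a * a * a * a * a * a * c))
                                          (- 0ℚ - (b + b - a * a))
      (- (6912 * (α * β * (α * β) + α * β * (b * b - (a * c + a * c))
                  + (b * b - (a * c + a * c)) * (b * b - (a * c + a * c)))))
                                          (α * β - (b * b - (a * c + a * c)))
      (46656 * (β * β + c * c))           (- (β * β) - - (c * c))
  mirrored-disc₂-certificate α β a b c = combination (solve (α ∷ β ∷ a ∷ b ∷ c ∷ []) ℚ-ring)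

  mirrored⇒disc₂≤0 : ∀ {α β} → β ≢ 0ℚ → Mirrored (- (β * β)) (α * β) (- 0ℚ) → disc₂ α β ≤ 0ℚ
  mirrored⇒disc₂≤0 {α} {β} β≢0 (a , b , c , e₄ , e₂ , e₀) = scaled-nonpositive
    (*-pos (square-pos β≢0) (positive⁻¹ 1728))
    (vanish₃ (mirrored-disc₂-certificate α β a b c) (p≡q⇒p-q≡0 e₄) (p≡q⇒p-q≡0 e₂) (p≡q⇒p-q≡0 e₀))
    (square-times-positive-definite (c + c - a * a * a) (108 * c - 10 * (a * a * a)) (a * a * a))

  mirrored-of-reducible : ∀ {a₀ a₁ a₂} → a₀ ≢ 0ℚ → Irreducible (evenSextic a₀ a₁ a₂) →
    Reducible (evenSextic (- (a₀ * a₀)) (a₂ * a₀) (- a₁)) → Mirrored (- (a₀ * a₀)) (a₂ * a₀) (- a₁)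
  mirrored-of-reducible {a₀} {a₁} {a₂} a₀≢0 f-irr h-red =
    [ (λ (y , H[y]≡0) → contradiction (half-root⇒root {a₀} {a₁} {a₂} {y} a₀≢0 H[y]≡0) (irreducible⇒no-root f-irr))
    , id ]′ (even-sextic-splitting {c₀ = - (a₀ * a₀)} {c₂ = a₂ * a₀} {c₄ = - a₁} h-red)

  disc₁-negative : ∀ {α β} → α ≢ 0ℚ → β ≢ 0ℚ → Irreducible (evenSextic β α 0ℚ) →
    Reducible (evenSextic (- (β * β)) (0ℚ * β) (- α)) → disc₁ α β < 0ℚ
  disc₁-negative {α} {β} α≢0 β≢0 f-irr h-red = ≤∧≢⇒<
    (mirrored⇒disc₁≤0 {α} {β} α≢0 (mirrored-of-reducible β≢0 f-irr h-red))
    (λ Δ≡0 → irreducible⇒no-root f-irr (double-root₁ {α} {β} α≢0 Δ≡0))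

  disc₂-negative : ∀ {α β} → β ≢ 0ℚ → Irreducible (evenSextic β 0ℚ α) →
    Reducible (evenSextic (- (β * β)) (α * β) (- 0ℚ)) → disc₂ α β < 0ℚ
  disc₂-negative {α} {β} β≢0 f-irr h-red = ≤∧≢⇒<
    (mirrored⇒disc₂≤0 {α} {β} β≢0 (mirrored-of-reducible β≢0 f-irr h-red))
    (λ Δ≡0 → irreducible⇒no-root f-irr (double-root₂ {α} {β} β≢0 Δ≡0))

module IntegralCoefficients where
  open import Data.Nat using (suc)
  open import Data.Integer as ℤ using (ℤ; +_; -1ℤ)
  import Data.Integer.Properties as ℤ
  open import Data.Integer.Tactic.RingSolver using (solve)
  open import Data.List using ([]; _∷_)
  open import Data.Rational as ℚ using (ℚ; 0ℚ; _/_; _+_; _*_; -_; _-_; _<_; *<*)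
  open import Data.Rational.Literals using (fromℤ)
  open import Data.Rational.Properties using (↥p/↧p≡p; *-identityˡ; *-zeroˡ; neg-distribˡ-*)
  open import Relation.Binary.PropositionalEquality
  open Rational using (evenSextic; disc₁; disc₂; irreducible-resp; reducible-resp)

  ι : ℤ → ℚ
  ι z = z / 1

  ι≡fromℤ : ∀ z → ι z ≡ fromℤ z
  ι≡fromℤ z = ↥p/↧p≡p (fromℤ z)

  ι-+ : ∀ x y → ι (x ℤ.+ y) ≡ ι x + ι y
  ι-+ x y = trans (cong (_/ 1) (sym (cong₂ ℤ._+_ (ℤ.*-identityʳ x) (ℤ.*-identityʳ y))))
                  (sym (cong₂ _+_ (ι≡fromℤ x) (ι≡fromℤ y)))

  ι-* : ∀ x y → ι (x ℤ.* y) ≡ ι x * ι y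
  ι-* x y = sym (cong₂ _*_ (ι≡fromℤ x) (ι≡fromℤ y))

  ι-neg : ∀ x → ι (ℤ.- x) ≡ - ι x
  ι-neg x = trans (cong ι (sym (ℤ.-1*i≡-i x)))
    (trans (ι-* -1ℤ x) (trans (sym (neg-distribˡ-* ℚ.1ℚ (ι x))) (cong -_ (*-identityˡ (ι x)))))

  ι-- : ∀ x y → ι (x ℤ.- y) ≡ ι x - ι y
  ι-- x y = trans (ι-+ x (ℤ.- y)) (cong (λ t → ι x + t) (ι-neg y))

  ι-*³ : ∀ x y z → ι (x ℤ.* y ℤ.* z) ≡ ι x * ι y * ι z
  ι-*³ x y z = trans (ι-* (x ℤ.* y) z) (cong (_* ι z) (ι-* x y))

  ι-injective : ∀ {x y} → ι x ≡ ι y → x ≡ y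
  ι-injective {x} {y} ιx≡ιy = cong ℚ.↥_ (trans (sym (ι≡fromℤ x)) (trans ιx≡ιy (ι≡fromℤ y)))

  ι-<-reflect : ∀ {x y} → ι x < ι y → x ℤ.< y
  ι-<-reflect {x} {y} ιx<ιy with subst₂ _<_ (ι≡fromℤ x) (ι≡fromℤ y) ιx<ιy
  ... | *<* x*1<y*1 = subst₂ ℤ._<_ (ℤ.*-identityʳ x) (ℤ.*-identityʳ y) x*1<y*1

  0+0+x : ∀ x → + 0 ℤ.+ (+ 0 ℤ.+ x) ≡ x
  0+0+x x = trans (ℤ.+-identityˡ _) (ℤ.+-identityˡ x)

  toℚ-fPoly₁ : ∀ A B → toℚ (fPoly A B 1) ≈P evenSextic (ι B) (ι A) 0ℚ
  toℚ-fPoly₁ A B 0 = cong ι (0+0+x B)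
  toℚ-fPoly₁ A B 2 = cong ι (ℤ.+-identityˡ A)
  toℚ-fPoly₁ A B 1 = refl
  toℚ-fPoly₁ A B 3 = refl
  toℚ-fPoly₁ A B 4 = refl
  toℚ-fPoly₁ A B 5 = refl
  toℚ-fPoly₁ A B 6 = refl
  toℚ-fPoly₁ A B (suc (suc (suc (suc (suc (suc (suc _))))))) = refl

  toℚ-fPoly₂ : ∀ A B → toℚ (fPoly A B 2) ≈P evenSextic (ι B) 0ℚ (ι A)
  toℚ-fPoly₂ A B 0 = cong ι (0+0+x B)
  toℚ-fPoly₂ A B 4 = cong ι (ℤ.+-identityˡ A)
  toℚ-fPoly₂ A B 1 = refl
  toℚ-fPoly₂ A B 2 = refl
  toℚ-fPoly₂ A B 3 = refl
  toℚ-fPoly₂ A B 5 = refl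
  toℚ-fPoly₂ A B 6 = refl
  toℚ-fPoly₂ A B (suc (suc (suc (suc (suc (suc (suc _))))))) = refl

  toℚ-hPoly₁ : ∀ A B → toℚ (hPoly A B 1) ≈P evenSextic (- (ι B * ι B)) (0ℚ * ι B) (- ι A)
  toℚ-hPoly₁ A B 0 = trans (cong ι (0+0+x (ℤ.- (B ℤ.* B)))) (trans (ι-neg (B ℤ.* B)) (cong -_ (ι-* B B)))
  toℚ-hPoly₁ A B 2 = sym (*-zeroˡ (ι B))
  toℚ-hPoly₁ A B 4 = trans (cong ι (trans (ℤ.+-identityˡ _) (trans (ℤ.*-identityʳ _) (ℤ.-1*i≡-i A)))) (ι-neg A)
  toℚ-hPoly₁ A B 1 = refl
  toℚ-hPoly₁ A B 3 = refl
  toℚ-hPoly₁ A B 5 = refl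
  toℚ-hPoly₁ A B 6 = refl
  toℚ-hPoly₁ A B (suc (suc (suc (suc (suc (suc (suc _))))))) = refl

  toℚ-hPoly₂ : ∀ A B → toℚ (hPoly A B 2) ≈P evenSextic (- (ι B * ι B)) (ι A * ι B) (- 0ℚ)
  toℚ-hPoly₂ A B 0 = trans (cong ι (0+0+x (ℤ.- (B ℤ.* B)))) (trans (ι-neg (B ℤ.* B)) (cong -_ (ι-* B B)))
  toℚ-hPoly₂ A B 2 = trans (cong ι (trans (ℤ.+-identityˡ _) (cong₂ ℤ._*_ (ℤ.*-identityˡ A) (ℤ.*-identityʳ B)))) (ι-* A B)
  toℚ-hPoly₂ A B 1 = refl
  toℚ-hPoly₂ A B 3 = refl
  toℚ-hPoly₂ A B 4 = refl
  toℚ-hPoly₂ A B 5 = refl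
  toℚ-hPoly₂ A B 6 = refl
  toℚ-hPoly₂ A B (suc (suc (suc (suc (suc (suc (suc _))))))) = refl

  f₁-irreducible : ∀ A B → Irreducible (toℚ (fPoly A B 1)) → Irreducible (evenSextic (ι B) (ι A) 0ℚ)
  f₁-irreducible A B = irreducible-resp {toℚ (fPoly A B 1)} {evenSextic (ι B) (ι A) 0ℚ} (toℚ-fPoly₁ A B)

  f₂-irreducible : ∀ A B → Irreducible (toℚ (fPoly A B 2)) → Irreducible (evenSextic (ι B) 0ℚ (ι A))
  f₂-irreducible A B = irreducible-resp {toℚ (fPoly A B 2)} {evenSextic (ι B) 0ℚ (ι A)} (toℚ-fPoly₂ A B)

  h₁-reducible : ∀ A B → Reducible (toℚ (hPoly A B 1)) → Reducible (evenSextic (- (ι B * ι B)) (0ℚ * ι B) (- ι A))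
  h₁-reducible A B = reducible-resp {toℚ (hPoly A B 1)} {evenSextic (- (ι B * ι B)) (0ℚ * ι B) (- ι A)} (toℚ-hPoly₁ A B)

  h₂-reducible : ∀ A B → Reducible (toℚ (hPoly A B 2)) → Reducible (evenSextic (- (ι B * ι B)) (ι A * ι B) (- 0ℚ))
  h₂-reducible A B = reducible-resp {toℚ (hPoly A B 2)} {evenSextic (- (ι B * ι B)) (ι A * ι B) (- 0ℚ)} (toℚ-hPoly₂ A B)

  -- discCubic (d ∷ c ∷ b ∷ a ∷ [])
  discriminant : ℤ → ℤ → ℤ → ℤ → ℤ
  discriminant d c b a =
    (b ℤ.* b ℤ.* c ℤ.* c) ℤ.- (+ 4 ℤ.* a ℤ.* c ℤ.* c ℤ.* c)
      ℤ.- (+ 4 ℤ.* b ℤ.* b ℤ.* b ℤ.* d) ℤ.- (+ 27 ℤ.* a ℤ.* a ℤ.* d ℤ.* d)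
      ℤ.+ (+ 18 ℤ.* a ℤ.* b ℤ.* c ℤ.* d)
  {-# INLINE discriminant #-}

  discriminant-depressed : ∀ d c b a → b ≡ + 0 → a ≡ + 1 →
    discriminant d c b a ≡ ℤ.- (+ 4 ℤ.* (c ℤ.* c ℤ.* c)) ℤ.- + 27 ℤ.* (d ℤ.* d)
  discriminant-depressed d c _ _ refl refl = solve (d ∷ c ∷ [])

  discriminant-no-linear : ∀ d c b a → c ≡ + 0 → a ≡ + 1 →
    discriminant d c b a ≡ ℤ.- (+ 4 ℤ.* (b ℤ.* b ℤ.* b) ℤ.* d) ℤ.- + 27 ℤ.* (d ℤ.* d)
  discriminant-no-linear d _ b _ refl refl = solve (d ∷ b ∷ [])

  disc-gPoly₁ : ∀ A B → ι (discCubic (gPoly A B 1)) ≡ disc₁ (ι A) (ι B)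
  disc-gPoly₁ A B = begin
    ι (discCubic (gPoly A B 1))
      ≡⟨ cong ι (discriminant-depressed (+ 0 ℤ.+ (+ 0 ℤ.+ B)) (+ 0 ℤ.+ A) (+ 0) (+ 1) refl refl) ⟩
    ι (ℤ.- (+ 4 ℤ.* (c ℤ.* c ℤ.* c)) ℤ.- + 27 ℤ.* (d ℤ.* d))
      ≡⟨ cong ι (cong₂ (λ x y → ℤ.- (+ 4 ℤ.* (x ℤ.* x ℤ.* x)) ℤ.- + 27 ℤ.* (y ℤ.* y)) (ℤ.+-identityˡ A) (0+0+x B)) ⟩
    ι (ℤ.- (+ 4 ℤ.* (A ℤ.* A ℤ.* A)) ℤ.- + 27 ℤ.* (B ℤ.* B))
      ≡⟨ ι-- (ℤ.- (+ 4 ℤ.* (A ℤ.* A ℤ.* A))) (+ 27 ℤ.* (B ℤ.* B)) ⟩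
    ι (ℤ.- (+ 4 ℤ.* (A ℤ.* A ℤ.* A))) - ι (+ 27 ℤ.* (B ℤ.* B))
      ≡⟨ cong₂ _-_ (trans (ι-neg (+ 4 ℤ.* (A ℤ.* A ℤ.* A))) (cong -_ (trans (ι-* (+ 4) (A ℤ.* A ℤ.* A)) (cong (ι (+ 4) *_) (ι-*³ A A A)))))
                   (trans (ι-* (+ 27) (B ℤ.* B)) (cong (ι (+ 27) *_) (ι-* B B))) ⟩
    disc₁ (ι A) (ι B) ∎
    where
    open ≡-Reasoning
    c d : ℤ
    c = + 0 ℤ.+ A
    d = + 0 ℤ.+ (+ 0 ℤ.+ B)

  disc-gPoly₂ : ∀ A B → ι (discCubic (gPoly A B 2)) ≡ disc₂ (ι A) (ι B)
  disc-gPoly₂ A B = begin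
    ι (discCubic (gPoly A B 2))
      ≡⟨ cong ι (discriminant-no-linear (+ 0 ℤ.+ (+ 0 ℤ.+ B)) (+ 0) (+ 0 ℤ.+ A) (+ 1) refl refl) ⟩
    ι (ℤ.- (+ 4 ℤ.* (b ℤ.* b ℤ.* b) ℤ.* d) ℤ.- + 27 ℤ.* (d ℤ.* d))
      ≡⟨ cong ι (cong₂ (λ x y → ℤ.- (+ 4 ℤ.* (x ℤ.* x ℤ.* x) ℤ.* y) ℤ.- + 27 ℤ.* (y ℤ.* y)) (ℤ.+-identityˡ A) (0+0+x B)) ⟩
    ι (ℤ.- (+ 4 ℤ.* (A ℤ.* A ℤ.* A) ℤ.* B) ℤ.- + 27 ℤ.* (B ℤ.* B))
      ≡⟨ ι-- (ℤ.- (+ 4 ℤ.* (A ℤ.* A ℤ.* A) ℤ.* B)) (+ 27 ℤ.* (B ℤ.* B)) ⟩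
    ι (ℤ.- (+ 4 ℤ.* (A ℤ.* A ℤ.* A) ℤ.* B)) - ι (+ 27 ℤ.* (B ℤ.* B))
      ≡⟨ cong₂ _-_
           (trans (ι-neg (+ 4 ℤ.* (A ℤ.* A ℤ.* A) ℤ.* B)) (cong -_ (trans (ι-* (+ 4 ℤ.* (A ℤ.* A ℤ.* A)) B)
             (cong (_* ι B) (trans (ι-* (+ 4) (A ℤ.* A ℤ.* A)) (cong (ι (+ 4) *_) (ι-*³ A A A)))))))
           (trans (ι-* (+ 27) (B ℤ.* B)) (cong (ι (+ 27) *_) (ι-* B B))) ⟩
    disc₂ (ι A) (ι B) ∎
    where
    open ≡-Reasoning
    b d : ℤ
    b = + 0 ℤ.+ A
    d = + 0 ℤ.+ (+ 0 ℤ.+ B)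

  ι-nonzero : ∀ {x} → x ≢ + 0 → ι x ≢ 0ℚ
  ι-nonzero x≢0 ιx≡0 = x≢0 (ι-injective ιx≡0)

open import Data.Nat using (ℕ)
open import Data.Integer using (ℤ; _*_; _<_; +_)
open import Data.Integer.Properties using (*-zeroˡ; *-zeroʳ)
import Data.Rational as ℚ
open import Data.Product using (_×_)
open import Data.Sum using (_⊎_; inj₁; inj₂)
open import Relation.Binary.PropositionalEquality using (_≡_; _≢_; refl; sym; trans; cong; subst)
open Rational using (disc₁-negative; disc₂-negative)
open IntegralCoefficients using (ι; ι-nonzero; ι-<-reflect; f₁-irreducible; f₂-irreducible; h₁-reducible; h₂-reducible; disc-gPoly₁; disc-gPoly₂)

lemma3p1 : (A B : ℤ) (k : ℕ) → A * B ≢ + 0 → (k ≡ 1 ⊎ k ≡ 2) →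
    Irreducible (toℚ (fPoly A B k)) → Reducible (toℚ (hPoly A B k)) →
    discCubic (gPoly A B k) < + 0
lemma3p1 A B _ AB≢0 (inj₁ refl) f-irr h-red =
  ι-<-reflect {discCubic (gPoly A B 1)} {+ 0} (subst (ℚ._< ℚ.0ℚ) (sym (disc-gPoly₁ A B))
    (disc₁-negative {ι A} {ι B} (ι-nonzero A≢0) (ι-nonzero B≢0)
      (f₁-irreducible A B f-irr) (h₁-reducible A B h-red)))
  where
  A≢0 : A ≢ + 0
  A≢0 A≡0 = AB≢0 (trans (cong (_* B) A≡0) (*-zeroˡ B))
  B≢0 : B ≢ + 0
  B≢0 B≡0 = AB≢0 (trans (cong (A *_) B≡0) (*-zeroʳ A))
lemma3p1 A B _ AB≢0 (inj₂ refl) f-irr h-red =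
  ι-<-reflect {discCubic (gPoly A B 2)} {+ 0} (subst (ℚ._< ℚ.0ℚ) (sym (disc-gPoly₂ A B))
    (disc₂-negative {ι A} {ι B} (ι-nonzero B≢0)
      (f₂-irreducible A B f-irr) (h₂-reducible A B h-red)))
  where
  B≢0 : B ≢ + 0
  B≢0 B≡0 = AB≢0 (trans (cong (A *_) B≡0) (*-zeroʳ A))
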